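{- For every positive integer $d$: \begin{enumerate} \item $\nu_d(n)$ and $\eta_d(n)$ are non-increasing in $d$; \item $\eta_d(n)\le \nu_d(n)\le \eta_d(n)^2$; \item for all positive integers $k,n$: $\nu_d(kn)\le k\cdot\nu_d(n)$ and $\eta_d(kn)\le k\cdot\eta_d(n)$. \end{enumerate} Moreover, for all positive integers $d_1,d_2,n_1,n_2$: $\nu_{d_1d_2}(n_1n_2)\le \nu_{d_1}(n_1)\nu_{d_2}(n_2)$ and $\eta_{d_1d_2}(n_1n_2)\le\eta_{d_1}(n_1)\eta_{d_2}(n_2)$.
   Context: All graphs are finite, simple and undirected; $A_G$ is the adjacency matrix, $I$ the identity matrix, rank over $\mathbb{R}$, $\omega(G)$ the clique number. $\nu_d(n)$ is the minimum of $\operatorname{rank}(A_G+I)$ over all $n$-vertex graphs $G$ with $\omega(G)\le d$. $\eta_d(n)$ is the minimum of $\operatorname{rank}(A+I)$ over all $n\times n$ binary matrices $A$ with zero main diagonal such that $A+I$ has no principal minor (indexed by $d+1$ distinct indices) equal to the all-ones matrix $J_{d+1}$. -}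

module Defs where

open import Data.Nat using (ℕ; zero; suc; _≤_; _*_)
open import Data.Fin using (Fin; zero; suc; _≟_)
open import Data.Bool using (Bool; true; false; if_then_else_)
open import Data.Rational using (ℚ; 0ℚ; 1ℚ; _+_) renaming (_*_ to _*ℚ_)
open import Data.Product using (Σ; _×_; ∃-syntax)
open import Relation.Binary.PropositionalEquality using (_≡_; _≢_)
open import Relation.Nullary using (¬_; does)

-- Real matrices with rational entries; rank is computed over ℚ
-- (for rational matrices this coincides with the rank over ℝ).
Matrix : ℕ → Set
Matrix n = Fin n → Fin n → ℚ

sumFin : (k : ℕ) → (Fin k → ℚ) → ℚ
sumFin zero    f = 0ℚ
sumFin (suc k) f = f zero + sumFin k (λ i → f (suc i))

LinIndepRows : {n : ℕ} → Matrix n → (k : ℕ) → (Fin k → Fin n) → Set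
LinIndepRows {n} M k f =
  (c : Fin k → ℚ) →
  ((j : Fin n) → sumFin k (λ i → c i *ℚ M (f i) j) ≡ 0ℚ) →
  (i : Fin k) → c i ≡ 0ℚ

Rank : {n : ℕ} → Matrix n → ℕ → Set
Rank {n} M r =
  (Σ (Fin r → Fin n) λ f → LinIndepRows M r f) ×
  ((g : Fin (suc r) → Fin n) → ¬ LinIndepRows M (suc r) g)

BinMat : ℕ → Set
BinMat n = Fin n → Fin n → Bool

bool→ℚ : Bool → ℚ
bool→ℚ true  = 1ℚ
bool→ℚ false = 0ℚ

plusI : {n : ℕ} → BinMat n → Matrix n
plusI A i j = bool→ℚ (A i j) + (if does (i ≟ j) then 1ℚ else 0ℚ)

ZeroDiag : {n : ℕ} → BinMat n → Set
ZeroDiag {n} A = (i : Fin n) → A i i ≡ false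

IsGraph : {n : ℕ} → BinMat n → Set
IsGraph {n} A = ZeroDiag A × ((i j : Fin n) → A i j ≡ A j i)

-- d+1 distinct indices whose principal submatrix of A + I is all ones
-- (for a graph: a clique of size d+1).
AllOnesPrincipal : {n : ℕ} → BinMat n → ℕ → Set
AllOnesPrincipal {n} A d =
  Σ (Fin (suc d) → Fin n) λ f →
    ((i j : Fin (suc d)) → i ≢ j → f i ≢ f j) ×
    ((i j : Fin (suc d)) → i ≢ j → A (f i) (f j) ≡ true)

CliqueAtMost : {n : ℕ} → BinMat n → ℕ → Set
CliqueAtMost A d = ¬ AllOnesPrincipal A d

-- IsNu d n m : m = ν_d(n)  (m is the minimum of rank(A_G + I) over
-- n-vertex graphs G with ω(G) ≤ d).
IsNu : ℕ → ℕ → ℕ → Set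
IsNu d n m =
  (∃[ A ] (IsGraph A × CliqueAtMost {n} A d × Rank (plusI A) m)) ×
  ((A : BinMat n) → IsGraph A → CliqueAtMost A d →
     (r : ℕ) → Rank (plusI A) r → m ≤ r)

IsEta : ℕ → ℕ → ℕ → Set
IsEta d n m =
  (∃[ A ] (ZeroDiag A × ¬ AllOnesPrincipal {n} A d × Rank (plusI A) m)) ×
  ((A : BinMat n) → ZeroDiag A → ¬ AllOnesPrincipal A d →
     (r : ℕ) → Rank (plusI A) r → m ≤ r)

{-# OPTIONS --safe #-}
module Submission where

-- Everything rests on two facts about rank over ℚ: a matrix that factors as X W through K
-- columns has rank at most K (Steinitz exchange), and a matrix of rank r factors through r of
-- its own rows. Each bound is then witnessed by a matrix B built from optimal witnesses, with
-- B + I an entrywise product of factorised matrices. For ν ≤ η², B is the symmetric part of an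
-- η-witness A and B + I = (A + I) ∘ (A + I)ᵀ. For the product bounds, B = A₁ ⊠ A₂ is the strong
-- product, B + I = (A₁ + I) ⊗ (A₂ + I), and a clique of A₁ ⊠ A₂ is determined by its projections,
-- which are cliques of A₁ and A₂; k disjoint copies of A are the strong product with the edgeless
-- graph on k vertices. Monotonicity in d and η ≤ ν hold because the admissible classes only grow.
-- Rank is defined classically, by a maximal independent family of rows, so the argument runs in
-- the double-negation monad; this is harmless since every conclusion is a decidable inequality.

open import Defs

module LinearAlgebra where

  open import Data.Nat using (ℕ; zero; suc; _≤_; z≤n)
  import Data.Nat as ℕ
  open import Data.Nat.Properties using (≤-refl; m≤n⇒m≤1+n)
  open import Data.Fin using (Fin; zero; suc; punchIn; combine; remQuot; _↑ˡ_; _↑ʳ_; _≟_)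
  open import Data.Fin.Properties using (remQuot-combine; all?; ¬∀⟶∃¬)
  open import Data.Vec.Functional using (_∷_)
  open import Data.Rational using (ℚ; 0ℚ; 1ℚ; _+_; _*_; -_; 1/_; ≢-nonZero)
  open import Data.Rational.Properties
    using (+-identityˡ; +-identityʳ; +-assoc; +-comm; *-comm; *-identityˡ; *-identityʳ; *-zeroˡ; *-zeroʳ;
           *-assoc; *-distribˡ-+; *-distribʳ-+; *-inverseˡ; *-inverseʳ; 1≢0)
  import Data.Rational.Properties as ℚ
  open import Data.Rational.Solver using (module +-*-Solver)
  open import Data.Bool using (if_then_else_)
  open import Data.Product using (Σ; ∃-syntax; _×_; _,_; proj₁; proj₂; uncurry)
  open import Function using (_∘_; id)
  open import Relation.Nullary using (¬_; yes; no; does)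
  open import Relation.Nullary.Decidable using (decidable-stable; ¬¬-excluded-middle)
  open import Relation.Nullary.Negation using (¬¬-Monad; contradiction)
  open import Effect.Monad using (RawMonad)
  open import Level using (0ℓ)
  open import Relation.Binary.PropositionalEquality
    using (_≡_; _≢_; refl; sym; trans; cong; cong₂; module ≡-Reasoning)

  open +-*-Solver
  open ≡-Reasoning
  open RawMonad (¬¬-Monad {0ℓ}) using (_>>=_; pure; _<$>_)

  sumFin-cong : ∀ k {f g : Fin k → ℚ} → (∀ i → f i ≡ g i) → sumFin k f ≡ sumFin k g
  sumFin-cong zero    f≗g = refl
  sumFin-cong (suc k) f≗g = cong₂ _+_ (f≗g zero) (sumFin-cong k (f≗g ∘ suc))

  sumFin-+ : ∀ k (f g : Fin k → ℚ) → sumFin k (λ i → f i + g i) ≡ sumFin k f + sumFin k g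
  sumFin-+ zero    f g = sym (+-identityˡ 0ℚ)
  sumFin-+ (suc k) f g = begin
    f zero + g zero + sumFin k (λ i → f (suc i) + g (suc i))
      ≡⟨ cong (f zero + g zero +_) (sumFin-+ k (f ∘ suc) (g ∘ suc)) ⟩
    f zero + g zero + (sumFin k (f ∘ suc) + sumFin k (g ∘ suc))
      ≡⟨ solve 4 (λ a b c d → (a :+ b) :+ (c :+ d) := (a :+ c) :+ (b :+ d)) refl (f zero) (g zero) _ _ ⟩
    f zero + sumFin k (f ∘ suc) + (g zero + sumFin k (g ∘ suc)) ∎

  sumFin-*ˡ : ∀ k a (f : Fin k → ℚ) → sumFin k (λ i → a * f i) ≡ a * sumFin k f
  sumFin-*ˡ zero    a f = sym (*-zeroʳ a)
  sumFin-*ˡ (suc k) a f =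
    trans (cong (a * f zero +_) (sumFin-*ˡ k a (f ∘ suc))) (sym (*-distribˡ-+ a (f zero) _))

  sumFin-*ʳ : ∀ k a (f : Fin k → ℚ) → sumFin k (λ i → f i * a) ≡ sumFin k f * a
  sumFin-*ʳ k a f = begin
    sumFin k (λ i → f i * a) ≡⟨ sumFin-cong k (λ i → *-comm (f i) a) ⟩
    sumFin k (λ i → a * f i) ≡⟨ sumFin-*ˡ k a f ⟩
    a * sumFin k f           ≡⟨ *-comm a _ ⟩
    sumFin k f * a           ∎

  sumFin-*-sumFin : ∀ k l (f : Fin k → ℚ) (g : Fin l → ℚ) →
                    sumFin k f * sumFin l g ≡ sumFin k (λ t → sumFin l (λ u → f t * g u))
  sumFin-*-sumFin k l f g =
    trans (sym (sumFin-*ʳ k (sumFin l g) f)) (sumFin-cong k (λ t → sym (sumFin-*ˡ l (f t) g)))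

  sumFin-punchIn : ∀ k (p : Fin (suc k)) (g : Fin (suc k) → ℚ) →
                   sumFin (suc k) g ≡ g p + sumFin k (g ∘ punchIn p)
  sumFin-punchIn k       zero    g = refl
  sumFin-punchIn (suc k) (suc p) g = begin
    g zero + sumFin (suc k) (g ∘ suc)
      ≡⟨ cong (g zero +_) (sumFin-punchIn k p (g ∘ suc)) ⟩
    g zero + (g (suc p) + sumFin k (g ∘ suc ∘ punchIn p))
      ≡⟨ solve 3 (λ a b c → a :+ (b :+ c) := b :+ (a :+ c)) refl (g zero) (g (suc p)) _ ⟩
    g (suc p) + (g zero + sumFin k (g ∘ suc ∘ punchIn p)) ∎

  sumFin-++ : ∀ k l (g : Fin (k ℕ.+ l) → ℚ) →
              sumFin (k ℕ.+ l) g ≡ sumFin k (λ i → g (i ↑ˡ l)) + sumFin l (λ j → g (k ↑ʳ j))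
  sumFin-++ zero    l g = sym (+-identityˡ _)
  sumFin-++ (suc k) l g = trans (cong (g zero +_) (sumFin-++ k l (g ∘ suc))) (sym (+-assoc (g zero) _ _))

  sumFin-combine : ∀ k l (g : Fin (k ℕ.* l) → ℚ) →
                   sumFin (k ℕ.* l) g ≡ sumFin k (λ t → sumFin l (λ u → g (combine t u)))
  sumFin-combine zero    l g = refl
  sumFin-combine (suc k) l g =
    trans (sumFin-++ l (k ℕ.* l) g)
          (cong (sumFin l (λ u → g (u ↑ˡ k ℕ.* l)) +_) (sumFin-combine k l (λ q → g (l ↑ʳ q))))

  sumFin-remQuot : ∀ k l (h : Fin k → Fin l → ℚ) →
                   sumFin (k ℕ.* l) (uncurry h ∘ remQuot l) ≡ sumFin k (λ t → sumFin l (h t))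
  sumFin-remQuot k l h = trans (sumFin-combine k l _)
    (sumFin-cong k λ t → sumFin-cong l λ u → cong (uncurry h) (remQuot-combine t u))

  δ : ∀ {k} → Fin k → Fin k → ℚ
  δ a b = if does (a ≟ b) then 1ℚ else 0ℚ

  sumFin-δ : ∀ k (a : Fin k) (F : Fin k → ℚ) → sumFin k (λ b → δ a b * F b) ≡ F a
  sumFin-δ (suc k) zero    F = begin
    1ℚ * F zero + sumFin k (λ b → 0ℚ * F (suc b))
      ≡⟨ cong₂ _+_ (*-identityˡ (F zero)) (sumFin-*ˡ k 0ℚ (F ∘ suc)) ⟩
    F zero + 0ℚ * sumFin k (F ∘ suc)               ≡⟨ cong (F zero +_) (*-zeroˡ (sumFin k (F ∘ suc))) ⟩
    F zero + 0ℚ                                    ≡⟨ +-identityʳ (F zero) ⟩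
    F zero                                         ∎
  sumFin-δ (suc k) (suc a) F = begin
    0ℚ * F zero + sumFin k (λ b → δ a b * F (suc b))
      ≡⟨ cong (_+ sumFin k (λ b → δ a b * F (suc b))) (*-zeroˡ (F zero)) ⟩
    0ℚ + sumFin k (λ b → δ a b * F (suc b))          ≡⟨ +-identityˡ _ ⟩
    sumFin k (λ b → δ a b * F (suc b))               ≡⟨ sumFin-δ k a (F ∘ suc) ⟩
    F (suc a)                                        ∎

  combination : ∀ {k n} → (Fin k → ℚ) → (Fin k → Fin n → ℚ) → Fin n → ℚ
  combination {k} c v j = sumFin k (λ i → c i * v i j)

  combination-scale : ∀ {k n} a (c : Fin k → ℚ) (v : Fin k → Fin n → ℚ) j →
                      combination (λ i → a * c i) v j ≡ a * combination c v j
  combination-scale {k} a c v j =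
    trans (sumFin-cong k (λ i → *-assoc a (c i) (v i j))) (sumFin-*ˡ k a (λ i → c i * v i j))

  combination-linear : ∀ {k n} a b (c c′ : Fin k → ℚ) (v : Fin k → Fin n → ℚ) j →
                       combination (λ i → a * c i + b * c′ i) v j ≡ a * combination c v j + b * combination c′ v j
  combination-linear {k} a b c c′ v j = begin
    combination (λ i → a * c i + b * c′ i) v j
      ≡⟨ sumFin-cong k (λ i → *-distribʳ-+ (v i j) (a * c i) (b * c′ i)) ⟩
    sumFin k (λ i → a * c i * v i j + b * c′ i * v i j)
      ≡⟨ sumFin-+ k _ _ ⟩
    combination (λ i → a * c i) v j + combination (λ i → b * c′ i) v j
      ≡⟨ cong₂ _+_ (combination-scale a c v j) (combination-scale b c′ v j) ⟩
    a * combination c v j + b * combination c′ v j ∎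

  combination-zero : ∀ {k n} (c : Fin k → ℚ) (v : Fin k → Fin n → ℚ) j →
                     (∀ i → c i ≡ 0ℚ) → combination c v j ≡ 0ℚ
  combination-zero {k} c v j c≡0 = begin
    combination c v j           ≡⟨ sumFin-cong k (λ i → cong (_* v i j) (c≡0 i)) ⟩
    sumFin k (λ i → 0ℚ * v i j) ≡⟨ sumFin-*ˡ k 0ℚ (λ i → v i j) ⟩
    0ℚ * sumFin k (λ i → v i j) ≡⟨ *-zeroˡ (sumFin k (λ i → v i j)) ⟩
    0ℚ                          ∎

  combination-punchIn : ∀ {k n} (t : Fin (suc k)) (c : Fin (suc k) → ℚ) (v : Fin (suc k) → Fin n → ℚ) j →
                        c t ≡ 0ℚ → combination c v j ≡ combination (c ∘ punchIn t) (v ∘ punchIn t) j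
  combination-punchIn {k} t c v j cₜ≡0 = begin
    combination c v j
      ≡⟨ sumFin-punchIn k t (λ i → c i * v i j) ⟩
    c t * v t j + S ≡⟨ cong (λ x → x * v t j + S) cₜ≡0 ⟩
    0ℚ * v t j + S  ≡⟨ solve 2 (λ x y → con 0ℚ :* x :+ y := y) refl (v t j) S ⟩
    S               ∎
    where S = combination (c ∘ punchIn t) (v ∘ punchIn t) j

  Independent : ∀ {k n} → (Fin k → Fin n → ℚ) → Set
  Independent v = ∀ c → (∀ j → combination c v j ≡ 0ℚ) → ∀ i → c i ≡ 0ℚ

  record Factorisation {m n} (M : Fin m → Fin n → ℚ) (K : ℕ) : Set where
    field
      left    : Fin m → Fin K → ℚ
      right   : Fin K → Fin n → ℚ
      factors : ∀ i j → M i j ≡ combination (left i) right j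

  open Factorisation

  factorisation-resp : ∀ {m n K} {M N : Fin m → Fin n → ℚ} →
                       (∀ i j → M i j ≡ N i j) → Factorisation M K → Factorisation N K
  factorisation-resp M≗N F = record
    { left = left F ; right = right F ; factors = λ i j → trans (sym (M≗N i j)) (factors F i j) }

  factorisation-reindex : ∀ {m m′ n n′ K} {M : Fin m → Fin n → ℚ} (f : Fin m′ → Fin m) (g : Fin n′ → Fin n) →
                          Factorisation M K → Factorisation (λ i j → M (f i) (g j)) K
  factorisation-reindex f g F = record
    { left = left F ∘ f ; right = λ t → right F t ∘ g ; factors = λ i j → factors F (f i) (g j) }

  factorisation-transpose : ∀ {m n K} {M : Fin m → Fin n → ℚ} →
                            Factorisation M K → Factorisation (λ i j → M j i) K
  factorisation-transpose {K = K} F = record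
    { left = λ i t → right F t i
    ; right = λ t j → left F j t
    ; factors = λ i j → trans (factors F j i) (sumFin-cong K (λ t → *-comm (left F j t) (right F t i)))
    }

  factorisation-hadamard : ∀ {m n K L} {M N : Fin m → Fin n → ℚ} →
                           Factorisation M K → Factorisation N L → Factorisation (λ i j → M i j * N i j) (K ℕ.* L)
  factorisation-hadamard {m} {n} {K} {L} {M} {N} F G =
    record { left = left′ ; right = right′ ; factors = factors′ }
    where
    left′ : Fin m → Fin (K ℕ.* L) → ℚ
    left′ i = uncurry (λ t u → left F i t * left G i u) ∘ remQuot L
    right′ : Fin (K ℕ.* L) → Fin n → ℚ
    right′ q j = uncurry (λ t u → right F t j * right G u j) (remQuot L q)
    factors′ : ∀ i j → M i j * N i j ≡ combination (left′ i) right′ j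
    factors′ i j = begin
      M i j * N i j
        ≡⟨ cong₂ _*_ (factors F i j) (factors G i j) ⟩
      combination (left F i) (right F) j * combination (left G i) (right G) j
        ≡⟨ sumFin-*-sumFin K L _ _ ⟩
      sumFin K (λ t → sumFin L (λ u → left F i t * right F t j * (left G i u * right G u j)))
        ≡⟨ sumFin-cong K (λ t → sumFin-cong L (λ u →
             solve 4 (λ a b c d → a :* b :* (c :* d) := a :* c :* (b :* d)) refl
                     (left F i t) (right F t j) (left G i u) (right G u j))) ⟩
      sumFin K (λ t → sumFin L (λ u → left F i t * left G i u * (right F t j * right G u j)))
        ≡⟨ sym (sumFin-remQuot K L _) ⟩
      combination (left′ i) right′ j ∎

  factorisation-id : ∀ {m n} (M : Fin m → Fin n → ℚ) → Factorisation M m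
  factorisation-id {m} M = record { left = δ ; right = M ; factors = λ i j → sym (sumFin-δ m i (λ t → M t j)) }

  factorisation-narrow : ∀ {m n K} {M : Fin m → Fin n → ℚ} (F : Factorisation M (suc K)) (t : Fin (suc K)) →
                         (∀ i → left F i t ≡ 0ℚ) → Factorisation M K
  factorisation-narrow F t column≡0 = record
    { left = λ i → left F i ∘ punchIn t
    ; right = right F ∘ punchIn t
    ; factors = λ i j → trans (factors F i j) (combination-punchIn t (left F i) (right F) j (column≡0 i))
    }

  p*q≡0⇒p≡0 : ∀ {p q} → q ≢ 0ℚ → p * q ≡ 0ℚ → p ≡ 0ℚ
  p*q≡0⇒p≡0 {p} {q} q≢0 pq≡0 = begin
    p                ≡⟨ sym (*-identityʳ p) ⟩
    p * 1ℚ           ≡⟨ cong (p *_) (sym (*-inverseʳ q)) ⟩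
    p * (q * 1/ q)   ≡⟨ sym (*-assoc p q (1/ q)) ⟩
    p * q * 1/ q     ≡⟨ cong (_* 1/ q) pq≡0 ⟩
    0ℚ * 1/ q        ≡⟨ *-zeroˡ (1/ q) ⟩
    0ℚ               ∎
    where instance _ = ≢-nonZero q≢0

  zeroRow⇒¬Independent : ∀ {k n} (v : Fin (suc k) → Fin n → ℚ) → (∀ j → v zero j ≡ 0ℚ) → ¬ Independent v
  zeroRow⇒¬Independent v v₀≡0 ind = 1≢0 (ind (1ℚ ∷ λ _ → 0ℚ) c·v≡0 zero)
    where
    c·v≡0 : ∀ j → 1ℚ * v zero j + combination (λ _ → 0ℚ) (v ∘ suc) j ≡ 0ℚ
    c·v≡0 j = cong₂ (λ x y → 1ℚ * x + y) (v₀≡0 j) (combination-zero _ (v ∘ suc) j (λ _ → refl))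

  rowReduce : ∀ {k n} → ℚ → (Fin k → ℚ) → (Fin (suc k) → Fin n → ℚ) → Fin k → Fin n → ℚ
  rowReduce α β v i j = α * v (suc i) j + β i * v zero j

  rowReduce-independent : ∀ {k n} α (β : Fin k → ℚ) (v : Fin (suc k) → Fin n → ℚ) → α ≢ 0ℚ →
                          Independent v → Independent (rowReduce α β v)
  rowReduce-independent {k} α β v α≢0 ind c′ c′·v′≡0 i = p*q≡0⇒p≡0 α≢0 (ind c c·v≡0 (suc i))
    where
    B : ℚ
    B = sumFin k (λ i → c′ i * β i)
    c : Fin (suc k) → ℚ
    c = B ∷ (λ i → c′ i * α)
    c·v≡0 : ∀ j → combination c v j ≡ 0ℚ
    c·v≡0 j = begin
      B * v zero j + A                               ≡⟨ +-comm (B * v zero j) A ⟩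
      A + B * v zero j                               ≡⟨ cong (A +_) (sym (sumFin-*ʳ k (v zero j) _)) ⟩
      A + sumFin k (λ i → c′ i * β i * v zero j)     ≡⟨ sym (sumFin-+ k _ _) ⟩
      sumFin k (λ i → c′ i * α * v (suc i) j + c′ i * β i * v zero j)
        ≡⟨ sumFin-cong k (λ i → solve 5 (λ c a x b y → c :* a :* x :+ c :* b :* y := c :* (a :* x :+ b :* y)) refl
             (c′ i) α (v (suc i) j) (β i) (v zero j)) ⟩
      combination c′ (rowReduce α β v) j             ≡⟨ c′·v′≡0 j ⟩
      0ℚ                                             ∎
      where A = combination (λ i → c′ i * α) (v ∘ suc) j

  rowReduce-factorisation : ∀ {k n L} α (β : Fin k → ℚ) {v : Fin (suc k) → Fin n → ℚ} →
                            (F : Factorisation v L) → Factorisation (rowReduce α β v) L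
  rowReduce-factorisation α β F = record
    { left = λ i u → α * left F (suc i) u + β i * left F zero u
    ; right = right F
    ; factors = λ i j → trans (cong₂ (λ x y → α * x + β i * y) (factors F (suc i) j) (factors F zero j))
                              (sym (combination-linear α (β i) (left F (suc i)) (left F zero) (right F) j))
    }

  -- Pivot on a nonzero coefficient t of the first row, clear column t from the other rows and recurse.
  steinitz : ∀ {K n} (v : Fin (suc K) → Fin n → ℚ) → Factorisation v K → ¬ Independent v
  steinitz v F with all? (λ t → left F zero t ℚ.≟ 0ℚ)
  ... | yes x₀≡0 = zeroRow⇒¬Independent v (λ j → trans (factors F zero j) (combination-zero _ (right F) j x₀≡0))
  steinitz {zero} v F | no x₀≢0 = contradiction (λ ()) x₀≢0
  steinitz {suc K} v F | no x₀≢0 with ¬∀⟶∃¬ _ _ (λ t → left F zero t ℚ.≟ 0ℚ) x₀≢0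
  ... | t , α≢0 =
    steinitz (rowReduce α β v) (factorisation-narrow F′ t pivot-cleared) ∘ rowReduce-independent α β v α≢0
    where
    α : ℚ
    α = left F zero t
    β : Fin (suc K) → ℚ
    β i = - left F (suc i) t
    F′ : Factorisation (rowReduce α β v) (suc K)
    F′ = rowReduce-factorisation α β F
    pivot-cleared : ∀ i → left F′ i t ≡ 0ℚ
    pivot-cleared i = solve 2 (λ a x → a :* x :+ (:- x) :* a := con 0ℚ) refl α (left F (suc i) t)

  Dependent : ∀ {k n} → (Fin k → Fin n → ℚ) → Set
  Dependent v = ∃[ c ] (∀ j → combination c v j ≡ 0ℚ) × ∃[ i ] c i ≢ 0ℚ

  ¬Independent⇒¬¬Dependent : ∀ {k n} (v : Fin k → Fin n → ℚ) → ¬ Independent v → ¬ ¬ Dependent v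
  ¬Independent⇒¬¬Dependent v ¬ind ¬dep = ¬ind λ c c·v≡0 i →
    decidable-stable (c i ℚ.≟ 0ℚ) (λ cᵢ≢0 → ¬dep (c , c·v≡0 , i , cᵢ≢0))

  InSpan : ∀ {k n} → (Fin n → ℚ) → (Fin k → Fin n → ℚ) → Set
  InSpan u v = ∃[ c ] ∀ j → u j ≡ combination c v j

  dependent⇒inSpan : ∀ {k n} (v : Fin (suc k) → Fin n → ℚ) → Independent (v ∘ suc) → Dependent v →
                     InSpan (v zero) (v ∘ suc)
  dependent⇒inSpan v ind (c , c·v≡0 , i , cᵢ≢0) = (λ t → - (1/ c₀) * c (suc t)) , v₀≡
    where
    c₀ = c zero
    S : ∀ j → ℚ
    S j = combination (c ∘ suc) (v ∘ suc) j
    c₀≢0 : c₀ ≢ 0ℚ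
    c₀≢0 c₀≡0 = cᵢ≢0 (c≡0 i)
      where
      S≡0 : ∀ j → S j ≡ 0ℚ
      S≡0 j = begin
        S j                  ≡⟨ solve 2 (λ x y → y := con 0ℚ :* x :+ y) refl (v zero j) (S j) ⟩
        0ℚ * v zero j + S j  ≡⟨ cong (λ z → z * v zero j + S j) (sym c₀≡0) ⟩
        c₀ * v zero j + S j  ≡⟨ c·v≡0 j ⟩
        0ℚ                   ∎
      c≡0 : ∀ i → c i ≡ 0ℚ
      c≡0 zero    = c₀≡0
      c≡0 (suc t) = ind (c ∘ suc) S≡0 t
    instance _ = ≢-nonZero c₀≢0
    v₀≡ : ∀ j → v zero j ≡ combination (λ t → - (1/ c₀) * c (suc t)) (v ∘ suc) j
    v₀≡ j = begin
      v zero j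
        ≡⟨ sym (*-identityˡ (v zero j)) ⟩
      1ℚ * v zero j
        ≡⟨ cong (_* v zero j) (sym (*-inverseˡ c₀)) ⟩
      1/ c₀ * c₀ * v zero j
        ≡⟨ solve 4 (λ d c x s → d :* c :* x := d :* (c :* x :+ s) :+ (:- d) :* s) refl (1/ c₀) c₀ (v zero j) (S j) ⟩
      1/ c₀ * (c₀ * v zero j + S j) + - (1/ c₀) * S j
        ≡⟨ cong (λ z → 1/ c₀ * z + - (1/ c₀) * S j) (c·v≡0 j) ⟩
      1/ c₀ * 0ℚ + - (1/ c₀) * S j
        ≡⟨ solve 2 (λ d s → d :* con 0ℚ :+ (:- d) :* s := (:- d) :* s) refl (1/ c₀) (S j) ⟩
      - (1/ c₀) * S j
        ≡⟨ sym (combination-scale (- (1/ c₀)) (c ∘ suc) (v ∘ suc) j) ⟩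
      combination (λ t → - (1/ c₀) * c (suc t)) (v ∘ suc) j ∎

  ¬¬-∀-Fin : ∀ {n} {P : Fin n → Set} → (∀ i → ¬ ¬ P i) → ¬ ¬ (∀ i → P i)
  ¬¬-∀-Fin {zero}  _   ¬∀ = ¬∀ (λ ())
  ¬¬-∀-Fin {suc n} ¬¬P ¬∀ = ¬¬P zero λ p₀ → ¬¬-∀-Fin (¬¬P ∘ suc) λ p₊ → ¬∀ λ { zero → p₀ ; (suc i) → p₊ i }

  rank⇒¬¬factorisation : ∀ {n r} {M : Matrix n} → Rank M r → ¬ ¬ Factorisation M r
  rank⇒¬¬factorisation {M = M} ((f , ind) , maximal) = do
    rows ← ¬¬-∀-Fin λ i → let v = λ k → M ((i ∷ f) k) in
      dependent⇒inSpan v ind <$> ¬Independent⇒¬¬Dependent v (maximal (i ∷ f))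
    pure record { left = proj₁ ∘ rows ; right = M ∘ f ; factors = proj₂ ∘ rows }

  ¬¬-threshold : ∀ {P : ℕ → Set} K → P 0 → ¬ P (suc K) → ¬ ¬ (∃[ r ] r ≤ K × P r × ¬ P (suc r))
  ¬¬-threshold zero    p₀ ¬p₁   = pure (0 , z≤n , p₀ , ¬p₁)
  ¬¬-threshold (suc K) p₀ ¬pₖ₊₂ = ¬¬-excluded-middle >>= λ where
    (yes pₖ₊₁) → pure (suc K , ≤-refl , pₖ₊₁ , ¬pₖ₊₂)
    (no ¬pₖ₊₁) → (λ (r , r≤K , pᵣ , ¬pᵣ₊₁) → r , m≤n⇒m≤1+n r≤K , pᵣ , ¬pᵣ₊₁) <$> ¬¬-threshold K p₀ ¬pₖ₊₁

  factorisation⇒¬¬rank : ∀ {n K} {M : Matrix n} → Factorisation M K → ¬ ¬ (∃[ r ] r ≤ K × Rank M r)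
  factorisation⇒¬¬rank {n} {K} {M} F =
    (λ (r , r≤K , indep , ¬indep) → r , r≤K , indep , λ g ind → ¬indep (g , ind))
      <$> ¬¬-threshold {λ s → Σ (Fin s → Fin n) (LinIndepRows M s)} K ((λ ()) , λ _ _ ())
            (λ (g , ind) → steinitz (M ∘ g) (factorisation-reindex g id F) ind)

module Graphs where

  open import Data.Nat using (ℕ; zero; suc; s≤s; _≤_; _≤?_; _*_)
  open import Data.Nat.Properties using (≤-trans; ≰⇒>; 1+n≰n; *-mono-≤)
  open import Data.Fin using (Fin; zero; suc; combine; remQuot; inject≤; _≟_)
  open import Data.Fin.Properties using (combine-remQuot; combine-injective; inject≤-injective; injective⇒≤; any?)
  open import Data.Vec.Functional using (_∷_)
  open import Data.Rational using () renaming (_*_ to _*ℚ_)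
  open import Data.Rational.Properties using (+-identityʳ)
  open import Data.Bool using (true; false; _∧_; _∨_; not)
  open import Data.Bool.Properties
    using (∧-comm; ∧-zeroʳ; ∧-identityʳ; ∨-zeroʳ; ∨-identityʳ; ∧-conicalˡ; ∧-conicalʳ)
  open import Data.Product using (∃-syntax; _,_; proj₁; proj₂)
  open import Function using (_∘_)
  open import Relation.Nullary using (¬_; Dec; yes; no; does)
  open import Relation.Nullary.Decidable using (decidable-stable; dec-true; dec-false)
  open import Relation.Nullary.Negation using (contradiction)
  open import Relation.Binary.PropositionalEquality
    using (_≡_; _≢_; refl; sym; trans; cong; cong₂; module ≡-Reasoning)

  open LinearAlgebra

  does-≟-sym : ∀ {n} (i j : Fin n) → does (i ≟ j) ≡ does (j ≟ i)
  does-≟-sym i j with i ≟ j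
  ... | yes refl = sym (dec-true (i ≟ i) refl)
  ... | no i≢j   = sym (dec-false (j ≟ i) (i≢j ∘ sym))

  _⁼ : ∀ {n} → BinMat n → BinMat n
  (A ⁼) i j = A i j ∨ does (i ≟ j)

  ⁼-refl : ∀ {n} (A : BinMat n) i → (A ⁼) i i ≡ true
  ⁼-refl A i = trans (cong (A i i ∨_) (dec-true (i ≟ i) refl)) (∨-zeroʳ (A i i))

  ⁼-off : ∀ {n} (A : BinMat n) {i j} → i ≢ j → (A ⁼) i j ≡ A i j
  ⁼-off A {i} {j} i≢j = trans (cong (A i j ∨_) (dec-false (i ≟ j) i≢j)) (∨-identityʳ (A i j))

  ⁼-sym : ∀ {n} {A : BinMat n} → (∀ i j → A i j ≡ A j i) → ∀ i j → (A ⁼) i j ≡ (A ⁼) j i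
  ⁼-sym A-sym i j = cong₂ _∨_ (A-sym i j) (does-≟-sym i j)

  plusI≡⁼ : ∀ {n} (A : BinMat n) → ZeroDiag A → ∀ i j → plusI A i j ≡ bool→ℚ ((A ⁼) i j)
  plusI≡⁼ A zd i j with i ≟ j
  ... | yes refl rewrite zd i = refl
  ... | no _     = trans (+-identityʳ _) (cong bool→ℚ (sym (∨-identityʳ (A i j))))

  offDiagonal : ∀ {n} → BinMat n → BinMat n
  offDiagonal R i j = R i j ∧ not (does (i ≟ j))

  offDiagonal-zeroDiag : ∀ {n} (R : BinMat n) → ZeroDiag (offDiagonal R)
  offDiagonal-zeroDiag R i = trans (cong (λ b → R i i ∧ not b) (dec-true (i ≟ i) refl)) (∧-zeroʳ (R i i))

  offDiagonal-sym : ∀ {n} (R : BinMat n) → (∀ i j → R i j ≡ R j i) →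
                    ∀ i j → offDiagonal R i j ≡ offDiagonal R j i
  offDiagonal-sym R R-sym i j = cong₂ (λ a b → a ∧ not b) (R-sym i j) (does-≟-sym i j)

  plusI-offDiagonal : ∀ {n} (R : BinMat n) → (∀ i → R i i ≡ true) →
                      ∀ i j → plusI (offDiagonal R) i j ≡ bool→ℚ (R i j)
  plusI-offDiagonal R R-refl i j with i ≟ j
  ... | yes refl rewrite R-refl i = refl
  ... | no _     = trans (+-identityʳ _) (cong bool→ℚ (∧-identityʳ (R i j)))

  bool→ℚ-∧ : ∀ x y → bool→ℚ (x ∧ y) ≡ bool→ℚ x *ℚ bool→ℚ y
  bool→ℚ-∧ true  true  = refl
  bool→ℚ-∧ true  false = refl
  bool→ℚ-∧ false true  = refl
  bool→ℚ-∧ false false = refl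

  allOnesPrincipal⁼ : ∀ {n d} (A : BinMat n) (f : Fin (suc d) → Fin n) → (∀ i j → i ≢ j → f i ≢ f j) →
                      (∀ i j → i ≢ j → (A ⁼) (f i) (f j) ≡ true) → AllOnesPrincipal A d
  allOnesPrincipal⁼ A f f-distinct adj⁼ =
    f , f-distinct , λ i j i≢j → trans (sym (⁼-off A (f-distinct i j i≢j))) (adj⁼ i j i≢j)

  allOnesPrincipal-≤ : ∀ {n d d′} (A : BinMat n) → d ≤ d′ → AllOnesPrincipal A d′ → AllOnesPrincipal A d
  allOnesPrincipal-≤ A d≤d′ (f , f-distinct , adj) =
    f ∘ ι , (λ i j i≢j → f-distinct (ι i) (ι j) (i≢j ∘ ι-injective))
          , (λ i j i≢j → adj (ι i) (ι j) (i≢j ∘ ι-injective))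
    where
    ι = λ i → inject≤ i (s≤s d≤d′)
    ι-injective = λ {i} {j} → inject≤-injective (s≤s d≤d′) (s≤s d≤d′) i j

  symmetricClosure⁼ : ∀ {n} → BinMat n → BinMat n
  symmetricClosure⁼ A i j = (A ⁼) i j ∧ (A ⁼) j i

  symmetricPart : ∀ {n} → BinMat n → BinMat n
  symmetricPart A = offDiagonal (symmetricClosure⁼ A)

  symmetricPart-isGraph : ∀ {n} (A : BinMat n) → IsGraph (symmetricPart A)
  symmetricPart-isGraph A =
    offDiagonal-zeroDiag (symmetricClosure⁼ A)
    , offDiagonal-sym (symmetricClosure⁼ A) (λ i j → ∧-comm ((A ⁼) i j) ((A ⁼) j i))

  symmetricPart-cliqueFree : ∀ {n d} (A : BinMat n) →
                             ¬ AllOnesPrincipal A d → ¬ AllOnesPrincipal (symmetricPart A) d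
  symmetricPart-cliqueFree A ¬K (f , f-distinct , adj) = ¬K (allOnesPrincipal⁼ A f f-distinct λ i j i≢j →
    ∧-conicalˡ _ _ (∧-conicalˡ (symmetricClosure⁼ A (f i) (f j)) _ (adj i j i≢j)))

  factorisation-symmetricPart : ∀ {n K} (A : BinMat n) → ZeroDiag A →
                                Factorisation (plusI A) K → Factorisation (plusI (symmetricPart A)) (K * K)
  factorisation-symmetricPart A zd F =
    factorisation-resp plusI≡ (factorisation-hadamard F (factorisation-transpose F))
    where
    plusI≡ : ∀ i j → plusI A i j *ℚ plusI A j i ≡ plusI (symmetricPart A) i j
    plusI≡ i j = sym (begin
      plusI (symmetricPart A) i j
        ≡⟨ plusI-offDiagonal (symmetricClosure⁼ A) (λ i → cong₂ _∧_ (⁼-refl A i) (⁼-refl A i)) i j ⟩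
      bool→ℚ ((A ⁼) i j ∧ (A ⁼) j i)
        ≡⟨ bool→ℚ-∧ ((A ⁼) i j) ((A ⁼) j i) ⟩
      bool→ℚ ((A ⁼) i j) *ℚ bool→ℚ ((A ⁼) j i)
        ≡⟨ sym (cong₂ _*ℚ_ (plusI≡⁼ A zd i j) (plusI≡⁼ A zd j i)) ⟩
      plusI A i j *ℚ plusI A j i ∎)
      where open ≡-Reasoning

  _⊗_ : ∀ {n₁ n₂} → BinMat n₁ → BinMat n₂ → BinMat (n₁ * n₂)
  _⊗_ {n₁} {n₂} R₁ R₂ s s′ = R₁ (proj₁ (rq s)) (proj₁ (rq s′)) ∧ R₂ (proj₂ (rq s)) (proj₂ (rq s′))
    where rq = remQuot {n₁} n₂

  _⊠_ : ∀ {n₁ n₂} → BinMat n₁ → BinMat n₂ → BinMat (n₁ * n₂)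
  A₁ ⊠ A₂ = offDiagonal ((A₁ ⁼) ⊗ (A₂ ⁼))

  record Representatives {m n} (g : Fin m → Fin n) : Set where
    field
      size           : ℕ
      representative : Fin size → Fin m
      class          : Fin m → Fin size
      class-correct  : ∀ i → g (representative (class i)) ≡ g i
      distinct       : ∀ a b → g (representative a) ≡ g (representative b) → a ≡ b

    sameClass⇒≡ : ∀ {i j} → class i ≡ class j → g i ≡ g j
    sameClass⇒≡ {i} {j} e =
      trans (sym (class-correct i)) (trans (cong (g ∘ representative) e) (class-correct j))

  representatives : ∀ {m n} (g : Fin m → Fin n) → Representatives g
  representatives {zero} g = record
    { size = 0 ; representative = λ () ; class = λ () ; class-correct = λ () ; distinct = λ () }
  representatives {suc m} g = extend (any? λ a → g zero ≟ g (suc (representative a)))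
    where
    open Representatives (representatives (g ∘ suc))
    extend : Dec (∃[ a ] g zero ≡ g (suc (representative a))) → Representatives g
    extend (yes (a , g₀≡)) = record
      { size = size
      ; representative = suc ∘ representative
      ; class = a ∷ class
      ; class-correct = λ { zero → sym g₀≡ ; (suc i) → class-correct i }
      ; distinct = distinct
      }
    extend (no g₀-new) = record
      { size = suc size
      ; representative = zero ∷ (suc ∘ representative)
      ; class = zero ∷ (suc ∘ class)
      ; class-correct = λ { zero → refl ; (suc i) → class-correct i }
      ; distinct = distinct′
      }
      where
      distinct′ : ∀ a b → g ((zero ∷ (suc ∘ representative)) a) ≡ g ((zero ∷ (suc ∘ representative)) b) → a ≡ b
      distinct′ zero    zero    _ = refl
      distinct′ zero    (suc b) e = contradiction (b , e) g₀-new
      distinct′ (suc a) zero    e = contradiction (a , sym e) g₀-new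
      distinct′ (suc a) (suc b) e = cong suc (distinct a b e)

  representatives-size≤ : ∀ {m n d} (A : BinMat n) {g : Fin m → Fin n} → ¬ AllOnesPrincipal A d →
                          (∀ i j → (A ⁼) (g i) (g j) ≡ true) →
                          (R : Representatives g) → Representatives.size R ≤ d
  representatives-size≤ {d = d} A {g} ¬K adj R = decidable-stable (size ≤? d) λ size≰d →
    let d<size = ≰⇒> size≰d
        f = λ i → g (representative (inject≤ i d<size))
        f-distinct = λ i j i≢j e → i≢j (inject≤-injective d<size d<size i j (distinct _ _ e))
    in ¬K (allOnesPrincipal⁼ A f f-distinct λ i j _ → adj _ _)
    where open Representatives R

  distinct⇒injective : ∀ {m n} {f : Fin m → Fin n} → (∀ i j → i ≢ j → f i ≢ f j) → ∀ {i j} → f i ≡ f j → i ≡ j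
  distinct⇒injective f-distinct {i} {j} e = decidable-stable (i ≟ j) λ i≢j → f-distinct i j i≢j e

  module StrongProduct {n₁ n₂ : ℕ} (A₁ : BinMat n₁) (A₂ : BinMat n₂) where

    π₁ : Fin (n₁ * n₂) → Fin n₁
    π₁ = proj₁ ∘ remQuot {n₁} n₂

    π₂ : Fin (n₁ * n₂) → Fin n₂
    π₂ = proj₂ ∘ remQuot {n₁} n₂

    π-injective : ∀ {s s′} → π₁ s ≡ π₁ s′ → π₂ s ≡ π₂ s′ → s ≡ s′
    π-injective {s} {s′} e₁ e₂ =
      trans (sym (combine-remQuot {n₁} n₂ s)) (trans (cong₂ combine e₁ e₂) (combine-remQuot {n₁} n₂ s′))

    ⊗⁼-refl : ∀ s → ((A₁ ⁼) ⊗ (A₂ ⁼)) s s ≡ true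
    ⊗⁼-refl s = cong₂ _∧_ (⁼-refl A₁ (π₁ s)) (⁼-refl A₂ (π₂ s))

    ⊠-zeroDiag : ZeroDiag (A₁ ⊠ A₂)
    ⊠-zeroDiag = offDiagonal-zeroDiag ((A₁ ⁼) ⊗ (A₂ ⁼))

    ⊠-sym : (∀ i j → A₁ i j ≡ A₁ j i) → (∀ i j → A₂ i j ≡ A₂ j i) → ∀ s s′ → (A₁ ⊠ A₂) s s′ ≡ (A₁ ⊠ A₂) s′ s
    ⊠-sym sym₁ sym₂ = offDiagonal-sym ((A₁ ⁼) ⊗ (A₂ ⁼))
      λ s s′ → cong₂ _∧_ (⁼-sym sym₁ (π₁ s) (π₁ s′)) (⁼-sym sym₂ (π₂ s) (π₂ s′))

    factorisation-⊠ : ∀ {K₁ K₂} → ZeroDiag A₁ → ZeroDiag A₂ →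
                      Factorisation (plusI A₁) K₁ → Factorisation (plusI A₂) K₂ →
                      Factorisation (plusI (A₁ ⊠ A₂)) (K₁ * K₂)
    factorisation-⊠ zd₁ zd₂ F₁ F₂ = factorisation-resp plusI≡
      (factorisation-hadamard (factorisation-reindex π₁ π₁ F₁) (factorisation-reindex π₂ π₂ F₂))
      where
      plusI≡ : ∀ s s′ → plusI A₁ (π₁ s) (π₁ s′) *ℚ plusI A₂ (π₂ s) (π₂ s′) ≡ plusI (A₁ ⊠ A₂) s s′
      plusI≡ s s′ = sym (begin
        plusI (A₁ ⊠ A₂) s s′
          ≡⟨ plusI-offDiagonal ((A₁ ⁼) ⊗ (A₂ ⁼)) ⊗⁼-refl s s′ ⟩
        bool→ℚ ((A₁ ⁼) (π₁ s) (π₁ s′) ∧ (A₂ ⁼) (π₂ s) (π₂ s′))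
          ≡⟨ bool→ℚ-∧ ((A₁ ⁼) (π₁ s) (π₁ s′)) ((A₂ ⁼) (π₂ s) (π₂ s′)) ⟩
        bool→ℚ ((A₁ ⁼) (π₁ s) (π₁ s′)) *ℚ bool→ℚ ((A₂ ⁼) (π₂ s) (π₂ s′))
          ≡⟨ sym (cong₂ _*ℚ_ (plusI≡⁼ A₁ zd₁ (π₁ s) (π₁ s′)) (plusI≡⁼ A₂ zd₂ (π₂ s) (π₂ s′))) ⟩
        plusI A₁ (π₁ s) (π₁ s′) *ℚ plusI A₂ (π₂ s) (π₂ s′) ∎)
        where open ≡-Reasoning

    ⊠-cliqueFree : ∀ {d₁ d₂} → ¬ AllOnesPrincipal A₁ d₁ → ¬ AllOnesPrincipal A₂ d₂ →
                   ¬ AllOnesPrincipal (A₁ ⊠ A₂) (d₁ * d₂)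
    ⊠-cliqueFree ¬K₁ ¬K₂ (f , f-distinct , adj) =
      1+n≰n (≤-trans (injective⇒≤ φ-injective)
                     (*-mono-≤ (representatives-size≤ A₁ ¬K₁ adj₁ R₁) (representatives-size≤ A₂ ¬K₂ adj₂ R₂)))
      where
      adj⁼ : ∀ i j → ((A₁ ⁼) ⊗ (A₂ ⁼)) (f i) (f j) ≡ true
      adj⁼ i j with i ≟ j
      ... | yes refl = ⊗⁼-refl (f i)
      ... | no i≢j   = ∧-conicalˡ _ _ (adj i j i≢j)
      adj₁ : ∀ i j → (A₁ ⁼) (π₁ (f i)) (π₁ (f j)) ≡ true
      adj₁ i j = ∧-conicalˡ _ _ (adj⁼ i j)
      adj₂ : ∀ i j → (A₂ ⁼) (π₂ (f i)) (π₂ (f j)) ≡ true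
      adj₂ i j = ∧-conicalʳ _ _ (adj⁼ i j)
      R₁ = representatives (π₁ ∘ f)
      R₂ = representatives (π₂ ∘ f)
      open Representatives
      φ : Fin _ → Fin (size R₁ * size R₂)
      φ i = combine (class R₁ i) (class R₂ i)
      φ-injective : ∀ {i j} → φ i ≡ φ j → i ≡ j
      φ-injective e = let (e₁ , e₂) = combine-injective _ _ _ _ e in
        distinct⇒injective f-distinct (π-injective (sameClass⇒≡ R₁ e₁) (sameClass⇒≡ R₂ e₂))

  open StrongProduct public using (⊠-zeroDiag; ⊠-sym; factorisation-⊠; ⊠-cliqueFree)

  emptyGraph : ∀ k → BinMat k
  emptyGraph k _ _ = false

  emptyGraph-cliqueFree : ∀ k → ¬ AllOnesPrincipal (emptyGraph k) 1
  emptyGraph-cliqueFree k (_ , _ , adj) with adj zero (suc zero) (λ ())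
  ... | ()

open import Data.Nat using (ℕ; suc; _≤_; _≤?_; _*_)
open import Data.Nat.Properties using (≤-refl; ≤-trans; n≤1+n; *-identityˡ)
open import Data.Product using (∃-syntax; _×_; _,_; proj₁)
open import Function using (_∘_; id)
open import Relation.Nullary using (¬_)
open import Relation.Nullary.Decidable using (decidable-stable)
open import Relation.Nullary.Negation using (¬¬-Monad; contraposition)
open import Effect.Monad using (RawMonad)
open import Level using (0ℓ)
open import Relation.Binary.PropositionalEquality using (refl; subst)

open LinearAlgebra
open Graphs

open RawMonad (¬¬-Monad {0ℓ}) using (_>>=_; pure; _<$>_; _<*>_)

MatrixClass : Set₁
MatrixClass = ∀ {n} → BinMat n → Set

RankLowerBound : MatrixClass → ℕ → ℕ → ℕ → Set
RankLowerBound Q d n m = (A : BinMat n) → Q A → ¬ AllOnesPrincipal A d → (r : ℕ) → Rank (plusI A) r → m ≤ r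

IsMinRank : MatrixClass → ℕ → ℕ → ℕ → Set
IsMinRank Q d n m = (∃[ A ] (Q A × ¬ AllOnesPrincipal {n} A d × Rank (plusI A) m)) × RankLowerBound Q d n m

isMinRank-antitone : ∀ (Q Q′ : MatrixClass) {d d′ n a b} → (∀ {n} {A : BinMat n} → Q A → Q′ A) → d ≤ d′ →
                     IsMinRank Q d n b → IsMinRank Q′ d′ n a → a ≤ b
isMinRank-antitone Q Q′ Q⊆Q′ d≤d′ ((A , q , ¬K , rank) , _) (_ , bound) =
  bound A (Q⊆Q′ q) (contraposition (allOnesPrincipal-≤ A d≤d′) ¬K) _ rank

rankLowerBound≤width : ∀ (Q : MatrixClass) {d n m K} → RankLowerBound Q d n m →
                       (∃[ B ] Q B × ¬ AllOnesPrincipal B d × ¬ ¬ Factorisation (plusI B) K) → m ≤ K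
rankLowerBound≤width Q {m = m} {K} bound (B , q , ¬K , ¬¬F) = decidable-stable (m ≤? K) do
  F ← ¬¬F
  (r , r≤K , rank) ← factorisation⇒¬¬rank F
  pure (≤-trans (bound B q ¬K r rank) r≤K)

record ProductClosed (Q : MatrixClass) : Set where
  field
    zeroDiag      : ∀ {n} (A : BinMat n) → Q A → ZeroDiag A
    ⊠-closed      : ∀ {n₁ n₂} (A₁ : BinMat n₁) (A₂ : BinMat n₂) → Q A₁ → Q A₂ → Q (A₁ ⊠ A₂)
    hasEmptyGraph : ∀ k → Q (emptyGraph k)

zeroDiag-productClosed : ProductClosed ZeroDiag
zeroDiag-productClosed = record
  { zeroDiag = λ _ → id
  ; ⊠-closed = λ A₁ A₂ _ _ → ⊠-zeroDiag A₁ A₂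
  ; hasEmptyGraph = λ _ _ → refl
  }

isGraph-productClosed : ProductClosed IsGraph
isGraph-productClosed = record
  { zeroDiag = λ _ → proj₁
  ; ⊠-closed = λ A₁ A₂ (_ , sym₁) (_ , sym₂) → ⊠-zeroDiag A₁ A₂ , ⊠-sym A₁ A₂ sym₁ sym₂
  ; hasEmptyGraph = λ _ → (λ _ → refl) , (λ _ _ → refl)
  }

module _ {Q : MatrixClass} (closed : ProductClosed Q) where
  open ProductClosed closed

  isMinRank-⊠ : ∀ {d₁ d₂ n₁ n₂ a b c} → IsMinRank Q (d₁ * d₂) (n₁ * n₂) a →
                IsMinRank Q d₁ n₁ b → IsMinRank Q d₂ n₂ c → a ≤ b * c
  isMinRank-⊠ (_ , bound) ((A₁ , q₁ , ¬K₁ , rank₁) , _) ((A₂ , q₂ , ¬K₂ , rank₂) , _) =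
    rankLowerBound≤width Q bound
      ( A₁ ⊠ A₂ , ⊠-closed A₁ A₂ q₁ q₂ , ⊠-cliqueFree A₁ A₂ ¬K₁ ¬K₂
      , (factorisation-⊠ A₁ A₂ (zeroDiag A₁ q₁) (zeroDiag A₂ q₂)
           <$> rank⇒¬¬factorisation rank₁ <*> rank⇒¬¬factorisation rank₂))

  -- emptyGraph k ⊠ A consists of k disjoint copies of A.
  isMinRank-copies : ∀ k {d n a b} → IsMinRank Q d (k * n) a → IsMinRank Q d n b → a ≤ k * b
  isMinRank-copies k {d} (_ , bound) ((A , q , ¬K , rank) , _) =
    rankLowerBound≤width Q bound
      ( emptyGraph k ⊠ A , ⊠-closed (emptyGraph k) A (hasEmptyGraph k) q
      , subst (¬_ ∘ AllOnesPrincipal (emptyGraph k ⊠ A)) (*-identityˡ d)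
          (⊠-cliqueFree (emptyGraph k) A (emptyGraph-cliqueFree k) ¬K)
      , (factorisation-⊠ (emptyGraph k) A (zeroDiag _ (hasEmptyGraph k)) (zeroDiag A q) (factorisation-id _)
           <$> rank⇒¬¬factorisation rank))

isMinRank-graph≤square : ∀ {d n a b} → IsMinRank ZeroDiag d n a → IsMinRank IsGraph d n b → b ≤ a * a
isMinRank-graph≤square ((A , zd , ¬K , rank) , _) (_ , bound) =
  rankLowerBound≤width IsGraph bound
    ( symmetricPart A , symmetricPart-isGraph A , symmetricPart-cliqueFree A ¬K
    , (factorisation-symmetricPart A zd <$> rank⇒¬¬factorisation rank))

lemma2p11 :
    ((d : ℕ) → 1 ≤ d →
      -- (1) monotonicity in d
      ((n : ℕ) → 1 ≤ n →
        ((m m′ : ℕ) → IsNu d n m → IsNu (suc d) n m′ → m′ ≤ m) ×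
        ((m m′ : ℕ) → IsEta d n m → IsEta (suc d) n m′ → m′ ≤ m)) ×
      -- (2) η_d(n) ≤ ν_d(n) ≤ η_d(n)^2
      ((n : ℕ) → 1 ≤ n → (a b : ℕ) → IsEta d n a → IsNu d n b →
        (a ≤ b) × (b ≤ a * a)) ×
      -- (3) subadditivity-type bounds
      ((k n : ℕ) → 1 ≤ k → 1 ≤ n →
        ((a b : ℕ) → IsNu d (k * n) a → IsNu d n b → a ≤ k * b) ×
        ((a b : ℕ) → IsEta d (k * n) a → IsEta d n b → a ≤ k * b))) ×
    -- (4) submultiplicativity
    ((d₁ d₂ n₁ n₂ : ℕ) → 1 ≤ d₁ → 1 ≤ d₂ → 1 ≤ n₁ → 1 ≤ n₂ →
      ((a b c : ℕ) → IsNu (d₁ * d₂) (n₁ * n₂) a → IsNu d₁ n₁ b → IsNu d₂ n₂ c →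
        a ≤ b * c) ×
      ((a b c : ℕ) → IsEta (d₁ * d₂) (n₁ * n₂) a → IsEta d₁ n₁ b → IsEta d₂ n₂ c →
        a ≤ b * c))
lemma2p11 =
  (λ d _ → (λ n _ → (λ _ _ → isMinRank-antitone IsGraph IsGraph id (n≤1+n d))
                    , (λ _ _ → isMinRank-antitone ZeroDiag ZeroDiag id (n≤1+n d)))
         , (λ n _ a b η ν → isMinRank-antitone IsGraph ZeroDiag proj₁ ≤-refl ν η
                          , isMinRank-graph≤square η ν)
         , (λ k n _ _ → (λ _ _ → isMinRank-copies isGraph-productClosed k)
                      , (λ _ _ → isMinRank-copies zeroDiag-productClosed k)))
  , (λ d₁ d₂ n₁ n₂ _ _ _ _ → (λ _ _ _ → isMinRank-⊠ isGraph-productClosed)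
                           , (λ _ _ _ → isMinRank-⊠ zeroDiag-productClosed))
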